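{- Let $k$ and $b$ be positive integers and let $p$ be an odd integer such that $$(2^{k+1}-1)(p^2+p+1) = 2^{k+1}p^2 + 2^b p^2 + 1.$$ Then $p + 1 \mid 2^b + 2$. -}

module Defs where

{-# OPTIONS --safe #-}
module Submission where

-- For any integers A, B, p there is the polynomial identity
--   (A - 1)(p² + p + 1) - (A p² + B p² + 1) + (B + 2) = (A - (B + 1)(p - 1) - 1)(p + 1),
-- so whenever the two bracketed expressions on the left agree, B + 2 is a multiple of p + 1.

open import Defs
open import Data.Nat using (ℕ; _≥_) renaming (_+_ to _+ℕ_)
open import Data.Integer using (ℤ; +_; _+_; _*_; _-_; _^_)
open import Data.Integer.Divisibility using (_∣_)
open import Data.Integer.Divisibility.Signed using (divides; ∣⇒∣ᵤ)
open import Data.Integer.Solver using (module +-*-Solver)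
open import Data.Product using (∃)
open import Relation.Binary.PropositionalEquality using (_≡_; refl; cong; module ≡-Reasoning)
open +-*-Solver

defect-factorisation : (A B p : ℤ) →
  (A - + 1) * (p ^ 2 + p + + 1) - (A * p ^ 2 + B * p ^ 2 + + 1) + (B + + 2)
    ≡ (A - (B + + 1) * (p - + 1) - + 1) * (p + + 1)
defect-factorisation = solve 3 (λ A B p →
  (A :- con (+ 1)) :* (p :^ 2 :+ p :+ con (+ 1)) :- (A :* p :^ 2 :+ B :* p :^ 2 :+ con (+ 1)) :+ (B :+ con (+ 2))
    := (A :- (B :+ con (+ 1)) :* (p :- con (+ 1)) :- con (+ 1)) :* (p :+ con (+ 1))) refl

x-x+y≡y : (x y : ℤ) → x - x + y ≡ y
x-x+y≡y = solve 2 (λ x y → x :- x :+ y := y) refl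

p+1∣B+2 : (A B p : ℤ) →
  (A - + 1) * (p ^ 2 + p + + 1) ≡ A * p ^ 2 + B * p ^ 2 + + 1 → p + + 1 ∣ B + + 2
p+1∣B+2 A B p eq = ∣⇒∣ᵤ (divides (A - (B + + 1) * (p - + 1) - + 1) (begin
  B + + 2                                        ≡⟨ x-x+y≡y R (B + + 2) ⟨
  R - R + (B + + 2)                              ≡⟨ cong (λ L → L - R + (B + + 2)) eq ⟨
  (A - + 1) * (p ^ 2 + p + + 1) - R + (B + + 2)  ≡⟨ defect-factorisation A B p ⟩
  (A - (B + + 1) * (p - + 1) - + 1) * (p + + 1)  ∎))
  where
  open ≡-Reasoning
  R : ℤ
  R = A * p ^ 2 + B * p ^ 2 + + 1

lemma11 : (k b : ℕ) → k ≥ 1 → b ≥ 1 → (p : ℤ) → (∃ λ m → p ≡ + 2 * m + + 1) → ((+ 2) ^ (k +ℕ 1) - + 1) * (p ^ 2 + p + + 1) ≡ (+ 2) ^ (k +ℕ 1) * p ^ 2 + (+ 2) ^ b * p ^ 2 + + 1 → (p + + 1) ∣ ((+ 2) ^ b + + 2)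
lemma11 k b _ _ p _ = p+1∣B+2 ((+ 2) ^ (k +ℕ 1)) ((+ 2) ^ b) p
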